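{- Let $\mathcal T$ be a $\mathfrak G$-symmetric poset with a $\mathfrak G$-compatible generating subposet $\mathcal Z$, and let $\lambda:\mathcal Z\to\Sigma(\Phi)$ be the associated $\mathfrak G$-stabilizer-preserving map. Let $\mathfrak G\mathcal Z^\lambda$ be the poset whose underlying set is $\{(z,g\lambda(z)):\ z\in\mathcal Z,\ g\in\mathfrak G\}$ (a set of pairs), ordered by $(z_1,\eta_1)\le(z_2,\eta_2)$ if and only if $z_1\le_{\mathcal Z}z_2$ and there exists $g\in\mathfrak G$ with $g^{ -1}\eta_1=\lambda(z_1)$ and $g^{ -1}\eta_2=\lambda(z_2)$. Then $\mathfrak G\mathcal Z^\lambda$ is isomorphic to $\mathcal T$ as a poset.
   Context: $W$ is a finite-dimensional real inner product space, $\mathcal H$ a finite set of linear hyperplanes in $W$ meeting in a single point such that the group $\mathfrak G\subseteq GL(W)$ generated by the reflections in them is finite; $\Phi$ is a fixed chamber (maximal cone) of the fan induced by $\mathcal H$ and $\Sigma(\Phi)$ is the set of nonempty faces of $\Phi$. For $\phi\in\Sigma(\Phi)$, $\mathfrak G_\phi=\{g\in\mathfrak G: g\phi=\phi\}$; distinct faces of $\Phi$ have distinct stabilizers. A $\mathfrak G$-symmetric poset is a poset $\mathcal T$ with a (left) action of $\mathfrak G$ on its elements preserving the partial order. An induced subposet $\mathcal Z$ of $\mathcal T$ is a generating subposet if (1) $\mathcal T=\bigsqcup_{z\in\mathcal Z}\mathfrak G\cdot z$ as a disjoint union of orbits, and (2) whenever $t_i=g_iz_i$ with $g_i\in\mathfrak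 G$, $z_i\in\mathcal Z$ ($i=1,2$), we have $t_1\le t_2$ iff $z_1\le z_2$ and there exists $g\in\mathfrak G$ with $t_i=gz_i$ for $i=1,2$. $\mathcal Z$ is $\mathfrak G$-compatible if for every $z\in\mathcal Z$ there is $\phi\in\Sigma(\Phi)$ with $\mathfrak G_z=\mathfrak G_\phi$ (where $\mathfrak G_z$ is the stabilizer of $z$); this $\phi$ is unique and the associated $\mathfrak G$-stabilizer-preserving map is $\lambda(z)=\phi$. -}

module Defs where

open import Data.Product using (Σ; ∃; ∃-syntax; _×_; _,_)
open import Relation.Binary.PropositionalEquality using (_≡_)
open import Relation.Binary.Structures using (IsPartialOrder)
open import Algebra.Structures using (IsGroup)
open import Function.Bundles using (_⇔_)

-- Abstract form of the reflection-group setting.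
-- 𝔊 is a group (with propositional equality); Cone is the set of cones
-- of the fan induced by ℋ, on which 𝔊 acts; IsFace picks out Σ(Φ), the
-- nonempty faces of the fixed chamber Φ.  Only the facts used about the
-- geometry are recorded.

record ReflSetting : Set₁ where
  field
    𝔊        : Set
    _∙_      : 𝔊 → 𝔊 → 𝔊
    ε        : 𝔊
    _⁻¹      : 𝔊 → 𝔊
    isGroup  : IsGroup _≡_ _∙_ ε _⁻¹
    Cone     : Set
    actC     : 𝔊 → Cone → Cone
    actC-ε   : ∀ η → actC ε η ≡ η
    actC-∙   : ∀ g h η → actC (g ∙ h) η ≡ actC g (actC h η)
    IsFace   : Cone → Set
    face-stab-inj : ∀ φ ψ → IsFace φ → IsFace ψ →
                    (∀ g → (actC g φ ≡ φ) ⇔ (actC g ψ ≡ ψ)) → φ ≡ ψ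

record SymPoset (S : ReflSetting) : Set₁ where
  open ReflSetting S
  field
    T         : Set
    _≤_       : T → T → Set
    isPartialOrder : IsPartialOrder _≡_ _≤_
    act       : 𝔊 → T → T
    act-ε     : ∀ t → act ε t ≡ t
    act-∙     : ∀ g h t → act (g ∙ h) t ≡ act g (act h t)
    act-mono  : ∀ g {s t} → s ≤ t → act g s ≤ act g t

-- A 𝔊-compatible generating subposet 𝒵 of 𝒯 together with its
-- associated 𝔊-stabilizer-preserving map λ.  𝒵 is given as a type Z with
-- an injective inclusion ι into T; its order is the induced one.

record CompatGenSub (S : ReflSetting) (P : SymPoset S) : Set₁ where
  open ReflSetting S
  open SymPoset P
  field
    Z        : Set
    ι        : Z → T
    ι-inj    : ∀ z z' → ι z ≡ ι z' → z ≡ z'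
    orbits-cover    : ∀ t → ∃[ z ] ∃[ g ] (t ≡ act g (ι z))
    orbits-disjoint : ∀ z z' g g' → act g (ι z) ≡ act g' (ι z') → z ≡ z'
    gen-order : ∀ g₁ g₂ z₁ z₂ →
                (act g₁ (ι z₁) ≤ act g₂ (ι z₂)) ⇔
                ((ι z₁ ≤ ι z₂) ×
                 ∃[ g ] ((act g₁ (ι z₁) ≡ act g (ι z₁)) × (act g₂ (ι z₂) ≡ act g (ι z₂))))
    lam        : Z → Cone
    lam-face   : ∀ z → IsFace (lam z)
    lam-stab   : ∀ z g → (act g (ι z) ≡ ι z) ⇔ (actC g (lam z) ≡ lam z)

-- The poset 𝔊𝒵^λ : pairs (z , η) with η = g λ(z) for some g.
-- Elements carry a witness g, so equality of elements is equality of
-- the pair (z , η) (relation _≈ᴳ_), ignoring the witness.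

module _ {S : ReflSetting} {P : SymPoset S} (Zd : CompatGenSub S P) where
  open ReflSetting S
  open SymPoset P
  open CompatGenSub Zd

  record GZλ : Set where
    constructor ⟨_,_,_,_⟩
    field
      z   : Z
      η   : Cone
      g   : 𝔊
      η≡  : η ≡ actC g (lam z)

  _≈ᴳ_ : GZλ → GZλ → Set
  p ≈ᴳ q = (GZλ.z p ≡ GZλ.z q) × (GZλ.η p ≡ GZλ.η q)

  _≤ᴳ_ : GZλ → GZλ → Set
  p ≤ᴳ q = (ι (GZλ.z p) ≤ ι (GZλ.z q)) ×
           ∃[ g ] ((actC (g ⁻¹) (GZλ.η p) ≡ lam (GZλ.z p)) ×
                   (actC (g ⁻¹) (GZλ.η q) ≡ lam (GZλ.z q)))

{-# OPTIONS --safe #-}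
module Submission where

-- The map (z , g λ(z)) ↦ g z is well defined and injective because, z and λ(z)
-- having the same stabiliser, g λ(z) = h λ(z) exactly when g z = h z.  The
-- same equivalence turns the defining condition of ≤ᴳ, g⁻¹ η = λ(z), into
-- g z = t for the image t of (z , η), so ≤ᴳ is condition (2) of a generating
-- subposet read through the map; surjectivity is condition (1).

open import Defs
open import Algebra.Structures using (IsGroup)
open import Data.Product using (∃; ∃-syntax; _,_)
open import Function.Bundles using (_⇔_; mk⇔; Equivalence)
open import Function.Construct.Composition using (_⇔-∘_)
open import Function.Construct.Symmetry using (⇔-sym)
open import Relation.Binary.Morphism.Structures using (IsOrderIsomorphism)
open import Relation.Binary.PropositionalEquality
  using (_≡_; refl; sym; trans; cong; module ≡-Reasoning)

open Equivalence using (to; from)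

module GroupActions {G : Set} {_∙_ : G → G → G} {ε : G} {_⁻¹ : G → G}
                    (isGroup : IsGroup _≡_ _∙_ ε _⁻¹) where
  open IsGroup isGroup using (inverseˡ; inverseʳ)

  record IsLeftAction {X : Set} (act : G → X → X) : Set where
    field
      act-ε : ∀ x → act ε x ≡ x
      act-∙ : ∀ g h x → act (g ∙ h) x ≡ act g (act h x)

    act-cancel : ∀ {g g'} → g ∙ g' ≡ ε → ∀ x → act g (act g' x) ≡ x
    act-cancel {g} {g'} gg'≡ε x = begin
      act g (act g' x) ≡⟨ act-∙ g g' x ⟨
      act (g ∙ g') x   ≡⟨ cong (λ k → act k x) gg'≡ε ⟩
      act ε x          ≡⟨ act-ε x ⟩
      x                ∎
      where open ≡-Reasoning

    act⁻¹-transpose : ∀ g x y → (act (g ⁻¹) y ≡ x) ⇔ (y ≡ act g x)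
    act⁻¹-transpose g x y = mk⇔
      (λ e → trans (sym (act-cancel (inverseʳ g) y)) (cong (act g) e))
      (λ e → trans (cong (act (g ⁻¹)) e) (act-cancel (inverseˡ g) x))

    act-≡⇔stabilises : ∀ g h x → (act g x ≡ act h x) ⇔ (act ((h ⁻¹) ∙ g) x ≡ x)
    act-≡⇔stabilises g h x = mk⇔
      (λ e → trans (act-∙ (h ⁻¹) g x) (from (act⁻¹-transpose h x (act g x)) e))
      (λ e → to (act⁻¹-transpose h x (act g x)) (trans (sym (act-∙ (h ⁻¹) g x)) e))

  open IsLeftAction

  sameStabiliser⇒sameOrbitFibres :
    ∀ {X Y : Set} {actX : G → X → X} {actY : G → Y → Y} →
    IsLeftAction actX → IsLeftAction actY → ∀ {x y} →
    (∀ g → (actX g x ≡ x) ⇔ (actY g y ≡ y)) →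
    ∀ g h → (actX g x ≡ actX h x) ⇔ (actY g y ≡ actY h y)
  sameStabiliser⇒sameOrbitFibres X-action Y-action {x} {y} stab g h =
    ⇔-sym (act-≡⇔stabilises Y-action g h y)
      ⇔-∘ (stab ((h ⁻¹) ∙ g) ⇔-∘ act-≡⇔stabilises X-action g h x)

module _ (S : ReflSetting) (P : SymPoset S) (Zd : CompatGenSub S P) where
  open ReflSetting S
  open SymPoset P
  open CompatGenSub Zd
  open GroupActions isGroup

  private
    T-action : IsLeftAction act
    T-action = record { act-ε = act-ε ; act-∙ = act-∙ }

    Cone-action : IsLeftAction actC
    Cone-action = record { act-ε = actC-ε ; act-∙ = actC-∙ }

  orbit-≡⇔orbitλ-≡ : ∀ z g h →
                     (act g (ι z) ≡ act h (ι z)) ⇔ (actC g (lam z) ≡ actC h (lam z))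
  orbit-≡⇔orbitλ-≡ z = sameStabiliser⇒sameOrbitFibres T-action Cone-action (lam-stab z)

  ⟦_⟧ : GZλ Zd → T
  ⟦ ⟨ z , _ , g , _ ⟩ ⟧ = act g (ι z)

  ≤ᴳ-witness⇔ : ∀ p h →
                (actC (h ⁻¹) (GZλ.η p) ≡ lam (GZλ.z p)) ⇔ (⟦ p ⟧ ≡ act h (ι (GZλ.z p)))
  ≤ᴳ-witness⇔ ⟨ z , _ , g , refl ⟩ h =
    ⇔-sym (orbit-≡⇔orbitλ-≡ z g h)
      ⇔-∘ IsLeftAction.act⁻¹-transpose Cone-action h (lam z) _

  ≈ᴳ⇔≡ : ∀ p q → _≈ᴳ_ Zd p q ⇔ (⟦ p ⟧ ≡ ⟦ q ⟧)
  ≈ᴳ⇔≡ p@(⟨ z₁ , _ , g₁ , refl ⟩) q@(⟨ z₂ , _ , g₂ , refl ⟩) = mk⇔ sameImage sameElement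
    where
    sameImage : _≈ᴳ_ Zd p q → ⟦ p ⟧ ≡ ⟦ q ⟧
    sameImage (refl , e) = from (orbit-≡⇔orbitλ-≡ z₁ g₁ g₂) e

    sameElement : ⟦ p ⟧ ≡ ⟦ q ⟧ → _≈ᴳ_ Zd p q
    sameElement e with refl ← orbits-disjoint z₁ z₂ g₁ g₂ e =
      refl , to (orbit-≡⇔orbitλ-≡ z₁ g₁ g₂) e

  ≤ᴳ⇔≤ : ∀ p q → _≤ᴳ_ Zd p q ⇔ (⟦ p ⟧ ≤ ⟦ q ⟧)
  ≤ᴳ⇔≤ p@(⟨ z₁ , _ , g₁ , _ ⟩) q@(⟨ z₂ , _ , g₂ , _ ⟩) = mk⇔
    (λ (z₁≤z₂ , h , e₁ , e₂) → from (gen-order g₁ g₂ z₁ z₂)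
      (z₁≤z₂ , h , to (≤ᴳ-witness⇔ p h) e₁ , to (≤ᴳ-witness⇔ q h) e₂))
    (λ le → let (z₁≤z₂ , h , e₁ , e₂) = to (gen-order g₁ g₂ z₁ z₂) le in
      z₁≤z₂ , h , from (≤ᴳ-witness⇔ p h) e₁ , from (≤ᴳ-witness⇔ q h) e₂)

  ⟦⟧-surjective : ∀ t → ∃ λ p → ∀ {q} → _≈ᴳ_ Zd q p → ⟦ q ⟧ ≡ t
  ⟦⟧-surjective t with z , g , t≡gz ← orbits-cover t =
    p , λ {q} q≈p → trans (to (≈ᴳ⇔≡ q p) q≈p) (sym t≡gz)
    where
    p : GZλ Zd
    p = ⟨ z , actC g (lam z) , g , refl ⟩

  ⟦⟧-isOrderIsomorphism : IsOrderIsomorphism (_≈ᴳ_ Zd) _≡_ (_≤ᴳ_ Zd) _≤_ ⟦_⟧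
  ⟦⟧-isOrderIsomorphism = record
    { isOrderMonomorphism = record
      { isOrderHomomorphism = record
        { cong = λ {p} {q} → to (≈ᴳ⇔≡ p q)
        ; mono = λ {p} {q} → to (≤ᴳ⇔≤ p q)
        }
      ; injective = λ {p} {q} → from (≈ᴳ⇔≡ p q)
      ; cancel    = λ {p} {q} → from (≤ᴳ⇔≤ p q)
      }
    ; surjective = ⟦⟧-surjective
    }

theorem6p6 : (S : ReflSetting) (P : SymPoset S) (Zd : CompatGenSub S P) →
             ∃[ f ] IsOrderIsomorphism (_≈ᴳ_ Zd) _≡_ (_≤ᴳ_ Zd) (SymPoset._≤_ P) f
theorem6p6 S P Zd = ⟦_⟧ S P Zd , ⟦⟧-isOrderIsomorphism S P Zd
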